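{- Let $\varepsilon>0$ be a real constant. Every $\varepsilon$-hitting set $H\subseteq\{0,1\}^*$ for the class of read-once branching programs of width $3$ is weakly $\varepsilon$-rich.
   Context: A branching program $P$ on Boolean variables $x_1,\ldots,x_n$ is a directed acyclic multigraph with one source; every non-sink node has out-degree 2, is labeled by a variable $x_i$, and its two outgoing edges are labeled $0$ and $1$; sinks are labeled $0$ or $1$. On input $\mathbf{a}\in\{0,1\}^n$ the computation starts at the source and at a node labeled $x_i$ follows the edge labeled $a_i$ until a sink is reached; the sink's label is $P(\mathbf{a})$. $P$ is read-once if every variable is queried at most once along each computational path. Programs are leveled: the nodes are partitioned into levels, the source forms level $0$, edges go only from level $k$ to level $k+1$, and the last level consists of all sinks; the width is the maximum number of nodes on a level. A set $H\subseteq\{0,1\}^*$ is an $\varepsilon$-hitting set for a class $\mathcal P$ of branching programs if for all sufficiently large $n$, for every $P\in\mathcal P$ on $n$ variables, $|P^{ -1}(1)|/2^n\geq\varepsilon$ implies there is $\mathbf{a}\in H\cap\{0,1\}^n$ with $P(\mathbf{a})=1$. A set $A\subseteq\{0,1\}^*$ is weakly $\varepsilon$-rich if for all sufficiently large $n$, for every index set $I\subseteq\{1,\ldots,n\}$, every partition $\{Q_1,\ldots,Q_q,R_1,\ldots,R_r\}$ of $I$ ($q,r\geq0$) and every $\mathbf{c}\in\{0,1\}^n$ the following holds: if $\left(1-\prod_{j=1}^q\left(1-2^{ -|Q_j|}\right)\right)\prod_{j=1}^r\left(1-2^{ -|R_j|}\right)\geq\varepsilon$, then there exists $\mathbf{a}\in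 A\cap\{0,1\}^n$ such that (for some $j\in\{1,\ldots,q\}$, $a_i=c_i$ for all $i\in Q_j$) and (for every $j\in\{1,\ldots,r\}$ there is $i\in R_j$ with $a_i\neq c_i$). (When $q=0$ the first factor and first condition are omitted; when $r=0$ the second factor and second condition are omitted.) -}

module Defs where

open import Data.Nat using (ℕ; zero; suc; _≤_; _<_)
open import Data.Bool using (Bool; true; false; if_then_else_)
open import Data.Fin using (Fin; zero; suc)
open import Data.Vec using (Vec; []; _∷_; lookup)
open import Data.List using (List; []; _∷_; _++_; length; map; concatMap)
open import Data.Nat.ListAction using (sum)
import Data.List as L
open import Data.List.Relation.Unary.All using (All)
open import Data.List.Relation.Unary.Any using (Any)
open import Data.List.Relation.Unary.Unique.Propositional using (Unique)
open import Data.Fin.Subset using (Subset; _∈_; ∣_∣; Nonempty)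
open import Data.Rational using (ℚ; 0ℚ; 1ℚ; ½; _*_; _-_; _≤_; _<_)
import Data.Rational as Q
open import Data.Integer using (+_)
open import Data.Product using (Σ; ∃; ∃-syntax; _×_; _,_)
open import Data.Empty using (⊥)
open import Relation.Binary.PropositionalEquality using (_≡_; _≢_)
open import Function.Bundles using (_⇔_)

-- Real thresholds.  A real ε > 0 is represented by its upper cut
-- Ge q  :⇔  q ≥ ε  (q rational).  The fields characterise exactly the
-- sets {q ∈ ℚ | q ≥ ε} for real ε > 0.

record PosReal : Set₁ where
  field
    Ge       : ℚ → Set
    upward   : ∀ {p q} → p Q.≤ q → Ge p → Ge q
    closed   : ∀ q → (∀ r → q Q.< r → Ge r) → Ge q    -- inf is attained
    bounded  : ∃[ q ] Ge q
    positive : ∃[ p ] (0ℚ Q.< p × (Ge p → ⊥))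

-- Leveled branching programs on variables Fin n.
-- 'Layers n m' is the part of a program starting at a level with m nodes
-- (nodes of that level are Fin m).

data Layers (n : ℕ) : ℕ → Set where
  sinks : ∀ {m} → (Fin m → Bool) → Layers n m
  layer : ∀ {m m'} → (Fin m → Fin n) → (Fin m → Bool → Fin m') →
          Layers n m' → Layers n m

-- a branching program: level 0 has exactly one node (the source)
BP : ℕ → Set
BP n = Layers n 1

-- the unique-source condition: every node of a later level has an
-- incoming edge (so no node other than the source has in-degree 0)
OneSource : ∀ {n m} → Layers n m → Set
OneSource (sinks _) = Data.Unit.⊤
  where import Data.Unit
OneSource {m = m} (layer {m' = m'} var next rest) =
  (∀ (j : Fin m') → ∃[ i ] ∃[ b ] next i b ≡ j) × OneSource rest

WidthAtMost : ∀ {n m} → ℕ → Layers n m → Set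
WidthAtMost {m = m} w (sinks _) = m Data.Nat.≤ w
WidthAtMost {m = m} w (layer _ _ rest) = m Data.Nat.≤ w × WidthAtMost w rest

eval : ∀ {n m} → Layers n m → Fin m → Vec Bool n → Bool
eval (sinks out) i a = out i
eval (layer var next rest) i a = eval rest (next i (lookup a (var i))) a

queries : ∀ {n m} → Layers n m → Fin m → Vec Bool n → List (Fin n)
queries (sinks out) i a = []
queries (layer var next rest) i a =
  var i ∷ queries rest (next i (lookup a (var i))) a

ReadOnce : ∀ {n} → BP n → Set
ReadOnce {n} P = ∀ (a : Vec Bool n) → Unique (queries P zero a)

IsROBP : ∀ {n} → ℕ → BP n → Set
IsROBP w P = OneSource P × WidthAtMost w P × ReadOnce P

runBP : ∀ {n} → BP n → Vec Bool n → Bool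
runBP P a = eval P zero a

allVecs : (n : ℕ) → List (Vec Bool n)
allVecs zero = [] ∷ []
allVecs (suc n) = concatMap (λ v → (false ∷ v) ∷ (true ∷ v) ∷ []) (allVecs n)

countTrue : ∀ {n} → (Vec Bool n → Bool) → ℕ
countTrue {n} f = sum (map (λ v → if f v then 1 else 0) (allVecs n))

half^ : ℕ → ℚ
half^ zero = 1ℚ
half^ (suc k) = ½ * half^ k

density : ∀ {n} → (Vec Bool n → Bool) → ℚ
density {n} f = ((+ countTrue f) Q./ 1) * half^ n

Lang : Set₁
Lang = (n : ℕ) → Vec Bool n → Set

IsHittingSetROBP3 : PosReal → Lang → Set
IsHittingSetROBP3 ε H = ∃[ n₀ ] ∀ n → n₀ Data.Nat.≤ n →
  ∀ (P : BP n) → IsROBP 3 P → PosReal.Ge ε (density (runBP P)) →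
  ∃[ a ] (H n a × runBP P a ≡ true)

Disjoint : ∀ {n} → Subset n → Subset n → Set
Disjoint {n} A B = ∀ (x : Fin n) → x ∈ A → x ∈ B → ⊥

IsPartition : ∀ {n} → Subset n → List (Subset n) → Set
IsPartition {n} I bs =
  All Nonempty bs ×
  (∀ (i j : Fin (length bs)) → i ≢ j → Disjoint (L.lookup bs i) (L.lookup bs j)) ×
  (∀ (x : Fin n) → (x ∈ I ⇔ Any (x ∈_) bs))

prodQ : List ℚ → ℚ
prodQ [] = 1ℚ
prodQ (x ∷ xs) = x * prodQ xs

missProb : ∀ {n} → Subset n → ℚ
missProb S = 1ℚ - half^ ∣ S ∣

-- first factor (omitted, i.e. = 1, when q = 0)
firstFactor : ∀ {n} → List (Subset n) → ℚ
firstFactor [] = 1ℚ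
firstFactor Qs@(_ ∷ _) = 1ℚ - prodQ (map missProb Qs)

richValue : ∀ {n} → List (Subset n) → List (Subset n) → ℚ
richValue Qs Rs = firstFactor Qs * prodQ (map missProb Rs)

AgreesOn : ∀ {n} → Vec Bool n → Vec Bool n → Subset n → Set
AgreesOn {n} a c S = ∀ (i : Fin n) → i ∈ S → lookup a i ≡ lookup c i

DiffersOn : ∀ {n} → Vec Bool n → Vec Bool n → Subset n → Set
DiffersOn {n} a c S = ∃[ i ] (i ∈ S × lookup a i ≢ lookup c i)

-- first condition (omitted when q = 0)
QCond : ∀ {n} → Vec Bool n → Vec Bool n → List (Subset n) → Set
QCond a c [] = Data.Unit.⊤
  where import Data.Unit
QCond a c Qs@(_ ∷ _) = Any (AgreesOn a c) Qs

IsWeaklyRich : PosReal → Lang → Set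
IsWeaklyRich ε A = ∃[ n₀ ] ∀ n → n₀ Data.Nat.≤ n →
  ∀ (I : Subset n) (Qs Rs : List (Subset n)) (c : Vec Bool n) →
  IsPartition I (Qs ++ Rs) →
  PosReal.Ge ε (richValue Qs Rs) →
  ∃[ a ] (A n a × QCond a c Qs × All (DiffersOn a c) Rs)

-- The witness for weak richness is a width-3 read-once program that reads the Q-blocks and then
-- the R-blocks, each variable once, and accepts exactly the inputs satisfying the richness
-- condition. Reading a Q-block, it remembers whether an earlier Q-block agreed with c (pass),
-- whether the current block agrees with c so far (wait), or neither (fail). The R-blocks run the
-- same automaton with pass and fail exchanged, so pass survives exactly when every R-block
-- differs from c somewhere. Since no variable is read twice, the acceptance probability
-- factorises over the blocks, a block of size k agreeing with c with probability 2^-k; this is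
-- the expression in the definition of weak richness, so an ε-hitting set must contain an
-- accepted input.

module Submission where

open import Defs

open import Data.Bool using (Bool; true; false; if_then_else_)
import Data.Bool.Properties as Bool
open import Data.Empty using (⊥; ⊥-elim)
open import Data.Fin using (Fin; zero; suc)
open import Data.Fin.Properties as Fin using (suc-injective)
open import Data.Fin.Subset using (Subset; Nonempty; ∣_∣; inside; outside)
  renaming (_∈_ to _∈ₛ_)
open import Data.Integer using (+_)
import Data.Integer as ℤ
import Data.Integer.Properties as ℤ
open import Data.List
  using (List; []; _∷_; _++_; [_]; map; concatMap; length; filter; allFin; null)
import Data.List as List
open import Data.List.Properties
  using (map-++; map-∘; map-cong; concat-++; length-map; length-filter; length-tabulate)
open import Data.List.Membership.Propositional using (_∈_; find)
open import Data.List.Membership.Propositional.Properties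
  using (∈-lookup; ∈-allFin; ∈-filter⁺; ∈-filter⁻; ∈-map⁺; ∈-map⁻; ∈-concatMap⁻)
open import Data.List.Relation.Unary.All as All using (All; []; _∷_)
open import Data.List.Relation.Unary.All.Properties using (++⁻) renaming (map⁺ to All-map⁺)
open import Data.List.Relation.Unary.Any as Any using (Any; here; there; any?)
open import Data.List.Relation.Unary.Any.Properties using (lookup-index)
open import Data.List.Relation.Unary.AllPairs using ([]; _∷_)
open import Data.List.Relation.Unary.Unique.Propositional using (Unique)
import Data.List.Relation.Unary.Unique.Propositional.Properties as Unique
open import Data.Nat as ℕ using (ℕ; zero; suc; z≤n; s≤s)
import Data.Nat.Properties as ℕ
import Data.Nat.Tactic.RingSolver as ℕ-Solver
open import Data.Nat.Coprimality as Coprime using (1-coprimeTo)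
open import Data.Nat.ListAction using (sum)
open import Data.Product using (_×_; _,_; proj₁; ∃-syntax; map₁; map₂)
open import Data.Rational as ℚ using (ℚ; mkℚ; 0ℚ; 1ℚ; ½; _+_; _*_; _-_; _/_)
open import Data.Rational.Properties as ℚ using (+-*-commutativeRing; normalize-coprime)
open import Data.Sum as Sum using (_⊎_; inj₁; inj₂; [_,_]′)
open import Data.Vec using (Vec; []; _∷_; lookup; _[_]≔_)
import Data.Vec as V using (here; there)
open import Data.Vec.Properties using (lookup∘update; lookup∘update′)
open import Function using (_∘_)
open import Level using (0ℓ)
open import Relation.Binary.PropositionalEquality hiding ([_])
open import Relation.Nullary.Decidable using (does; yes; no; dec⇒maybe; _⊎-dec_)
open import Relation.Unary using (Decidable)
open import Tactic.RingSolver using (solve-∀)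
open import Tactic.RingSolver.Core.AlmostCommutativeRing
  using (AlmostCommutativeRing; fromCommutativeRing)

-- Densities and fair coins

ℚ-ring : AlmostCommutativeRing 0ℓ 0ℓ
ℚ-ring = fromCommutativeRing +-*-commutativeRing (λ x → dec⇒maybe (0ℚ ℚ.≟ x))

mean : (Bool → ℚ) → ℚ
mean f = ½ * f false + ½ * f true

mean-const : ∀ x → mean (λ _ → x) ≡ x
mean-const x = trans (sym (ℚ.*-distribʳ-+ x ½ ½)) (ℚ.*-identityˡ x)

mean-cong : ∀ {f g : Bool → ℚ} → (∀ b → f b ≡ g b) → mean f ≡ mean g
mean-cong f≗g = cong₂ (λ x y → ½ * x + ½ * y) (f≗g false) (f≗g true)

mean-comm : ∀ (f : Bool → Bool → ℚ) →
            mean (λ b → mean (f b)) ≡ mean (λ b′ → mean (λ b → f b b′))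
mean-comm f = interchange (f false false) (f false true) (f true false) (f true true)
  where
  interchange : ∀ w x y z → ½ * (½ * w + ½ * x) + ½ * (½ * y + ½ * z)
                          ≡ ½ * (½ * w + ½ * y) + ½ * (½ * x + ½ * z)
  interchange = solve-∀ ℚ-ring

indicator : Bool → ℚ
indicator b = if b then 1ℚ else 0ℚ

ℕ→ℚ : ℕ → ℚ
ℕ→ℚ k = + k / 1

ℕ→ℚ-+ : ∀ a b → ℕ→ℚ (a ℕ.+ b) ≡ ℕ→ℚ a + ℕ→ℚ b
ℕ→ℚ-+ a b = sym (begin
  ℕ→ℚ a + ℕ→ℚ b                          ≡⟨ cong₂ _+_ (ℕ→ℚ-mkℚ a) (ℕ→ℚ-mkℚ b) ⟩
  mkℚ (+ a) 0 (c a) + mkℚ (+ b) 0 (c b)  ≡⟨⟩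
  (+ a ℤ.* + 1 ℤ.+ + b ℤ.* + 1) / 1
    ≡⟨ cong (_/ 1) (cong₂ ℤ._+_ (ℤ.*-identityʳ (+ a)) (ℤ.*-identityʳ (+ b))) ⟩
  ℕ→ℚ (a ℕ.+ b)                          ∎)
  where
  open ≡-Reasoning
  c : ∀ k → Coprime.Coprime k 1
  c k = Coprime.sym (1-coprimeTo k)
  ℕ→ℚ-mkℚ : ∀ k → ℕ→ℚ k ≡ mkℚ (+ k) 0 (c k)
  ℕ→ℚ-mkℚ k = normalize-coprime (c k)

countTrue-split : ∀ {n} (f : Vec Bool (suc n) → Bool) →
                  countTrue f ≡ countTrue (f ∘ (false ∷_)) ℕ.+ countTrue (f ∘ (true ∷_))
countTrue-split {n} f = sum-bits (allVecs n)
  where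
  count : Vec Bool (suc n) → ℕ
  count v = if f v then 1 else 0
  sum-bits : ∀ vs → sum (map count (concatMap (λ v → (false ∷ v) ∷ (true ∷ v) ∷ []) vs))
                  ≡ sum (map (count ∘ (false ∷_)) vs) ℕ.+ sum (map (count ∘ (true ∷_)) vs)
  sum-bits [] = refl
  sum-bits (v ∷ vs) =
    trans (cong (λ s → count (false ∷ v) ℕ.+ (count (true ∷ v) ℕ.+ s)) (sum-bits vs))
          (interchange (count (false ∷ v)) (count (true ∷ v)) _ _)
    where
    interchange : ∀ w x y z → w ℕ.+ (x ℕ.+ (y ℕ.+ z)) ≡ (w ℕ.+ y) ℕ.+ (x ℕ.+ z)
    interchange = ℕ-Solver.solve-∀

density-split : ∀ {n} (f : Vec Bool (suc n) → Bool) → density f ≡ mean (λ b → density (f ∘ (b ∷_)))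
density-split {n} f = begin
  ℕ→ℚ (countTrue f) * half^ (suc n)
    ≡⟨ cong (λ k → ℕ→ℚ k * half^ (suc n)) (countTrue-split f) ⟩
  ℕ→ℚ (count₀ ℕ.+ count₁) * (½ * half^ n)
    ≡⟨ cong (_* (½ * half^ n)) (ℕ→ℚ-+ count₀ count₁) ⟩
  (ℕ→ℚ count₀ + ℕ→ℚ count₁) * (½ * half^ n)
    ≡⟨ halve (ℕ→ℚ count₀) (ℕ→ℚ count₁) (half^ n) ⟩
  ½ * (ℕ→ℚ count₀ * half^ n) + ½ * (ℕ→ℚ count₁ * half^ n) ∎
  where
  open ≡-Reasoning
  count₀ = countTrue (f ∘ (false ∷_))
  count₁ = countTrue (f ∘ (true ∷_))
  halve : ∀ x y h → (x + y) * (½ * h) ≡ ½ * (x * h) + ½ * (y * h)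
  halve = solve-∀ ℚ-ring

density-cong : ∀ {n} {f g : Vec Bool n → Bool} → (∀ a → f a ≡ g a) → density f ≡ density g
density-cong {n} f≗g =
  cong (λ k → ℕ→ℚ k * half^ n) (cong sum (map-cong (cong (λ b → if b then 1 else 0) ∘ f≗g) (allVecs n)))

density-const : ∀ n b → density {n} (λ _ → b) ≡ indicator b
density-const zero true = refl
density-const zero false = refl
density-const (suc n) b =
  trans (density-split {n} (λ _ → b)) (trans (mean-cong (λ _ → density-const n b)) (mean-const (indicator b)))

density-split-at : ∀ {n} (v : Fin n) (f : Vec Bool n → Bool) →
                   density f ≡ mean (λ b → density (λ a → f (a [ v ]≔ b)))
density-split-at zero f = begin
  density f
    ≡⟨ density-split f ⟩
  mean (λ b → density (f ∘ (b ∷_)))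
    ≡⟨ mean-cong (λ b → sym (mean-const (density (f ∘ (b ∷_))))) ⟩
  mean (λ b → mean (λ c → density (f ∘ (b ∷_))))
    ≡⟨ mean-cong (λ b → sym (density-split (λ a → f (a [ zero ]≔ b)))) ⟩
  mean (λ b → density (λ a → f (a [ zero ]≔ b)))                 ∎
  where open ≡-Reasoning
density-split-at (suc w) f = begin
  density f
    ≡⟨ density-split f ⟩
  mean (λ c → density (f ∘ (c ∷_)))
    ≡⟨ mean-cong (λ c → density-split-at w (f ∘ (c ∷_))) ⟩
  mean (λ c → mean (λ b → density (λ a → f (c ∷ a [ w ]≔ b))))
    ≡⟨ mean-comm (λ c b → density (λ a → f (c ∷ a [ w ]≔ b))) ⟩
  mean (λ b → mean (λ c → density (λ a → f (c ∷ a [ w ]≔ b))))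
    ≡⟨ mean-cong (λ b → sym (density-split (λ a → f (a [ suc w ]≔ b)))) ⟩
  mean (λ b → density (λ a → f (a [ suc w ]≔ b)))                ∎
  where open ≡-Reasoning

-- Automata reading one variable per step

Step : ℕ → Set → Set
Step n S = Fin n × (S → Bool → S)

variables : ∀ {n S} → List (Step n S) → List (Fin n)
variables = map proj₁

run : ∀ {n S} → List (Step n S) → S → Vec Bool n → S
run [] s a = s
run ((v , δ) ∷ ts) s a = run ts (δ s (lookup a v)) a

run-++ : ∀ {n S} (ts us : List (Step n S)) s a → run (ts ++ us) s a ≡ run us (run ts s a) a
run-++ [] us s a = refl
run-++ ((v , δ) ∷ ts) us s a = run-++ ts us (δ s (lookup a v)) a

value : ∀ {n S} → List (Step n S) → (S → ℚ) → S → ℚ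
value [] p s = p s
value ((_ , δ) ∷ ts) p s = mean (λ b → value ts p (δ s b))

value-++ : ∀ {n S} (ts us : List (Step n S)) p s → value (ts ++ us) p s ≡ value ts (value us p) s
value-++ [] us p s = refl
value-++ ((_ , δ) ∷ ts) us p s = mean-cong (λ b → value-++ ts us p (δ s b))

run-update : ∀ {n S} {v : Fin n} (ts : List (Step n S)) → All (v ≢_) (variables ts) →
             ∀ s a b → run ts s (a [ v ]≔ b) ≡ run ts s a
run-update [] [] s a b = refl
run-update ((w , δ) ∷ ts) (v≢w ∷ v∉ts) s a b =
  trans (cong (λ x → run ts (δ s x) (a [ _ ]≔ b)) (lookup∘update′ (≢-sym v≢w) a b))
        (run-update ts v∉ts (δ s (lookup a w)) a b)

density-run : ∀ {n S} (ts : List (Step n S)) → Unique (variables ts) →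
              ∀ (g : S → Bool) s → density (λ a → g (run ts s a)) ≡ value ts (indicator ∘ g) s
density-run {n} [] [] g s = density-const n (g s)
density-run ((v , δ) ∷ ts) (v∉ts ∷ distinct) g s = begin
  density (λ a → g (run ts (δ s (lookup a v)) a))
    ≡⟨ density-split-at v _ ⟩
  mean (λ b → density (λ a → g (run ts (δ s (lookup (a [ v ]≔ b) v)) (a [ v ]≔ b))))
    ≡⟨ mean-cong (λ b → density-cong (forget-update b)) ⟩
  mean (λ b → density (λ a → g (run ts (δ s b) a)))
    ≡⟨ mean-cong (λ b → density-run ts distinct g (δ s b)) ⟩
  mean (λ b → value ts (indicator ∘ g) (δ s b))                   ∎
  where
  open ≡-Reasoning
  forget-update : ∀ b a → g (run ts (δ s (lookup (a [ v ]≔ b) v)) (a [ v ]≔ b)) ≡ g (run ts (δ s b) a)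
  forget-update b a = cong g (trans (cong (λ x → run ts (δ s x) (a [ v ]≔ b)) (lookup∘update v a b))
                                    (run-update ts v∉ts (δ s b) a b))

conjugate : ∀ {n S} → (S → S) → List (Step n S) → List (Step n S)
conjugate σ = map (map₂ (λ δ s b → σ (δ (σ s) b)))

variables-conjugate : ∀ {n S} (σ : S → S) (ts : List (Step n S)) → variables (conjugate σ ts) ≡ variables ts
variables-conjugate σ ts = sym (map-∘ ts)

module _ {S : Set} (σ : S → S) (involutive : ∀ s → σ (σ s) ≡ s) where

  run-conjugate : ∀ {n} (ts : List (Step n S)) s a → run (conjugate σ ts) s a ≡ σ (run ts (σ s) a)
  run-conjugate [] s a = sym (involutive s)
  run-conjugate ((v , δ) ∷ ts) s a =
    trans (run-conjugate ts _ a) (cong (λ t → σ (run ts t a)) (involutive (δ (σ s) (lookup a v))))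

  value-conjugate : ∀ {n} (ts : List (Step n S)) p s → value (conjugate σ ts) p s ≡ value ts (p ∘ σ) (σ s)
  value-conjugate [] p s = cong p (sym (involutive s))
  value-conjugate ((_ , δ) ∷ ts) p s =
    mean-cong (λ b → trans (value-conjugate ts p _) (cong (value ts (p ∘ σ)) (involutive (δ (σ s) b))))

-- Leveled read-once programs from automata

Reachable : ∀ {k} → (Fin k → Bool → Fin k) → List (Fin k) → Fin k → Set
Reachable δ ss t = Any (λ s → δ s false ≡ t ⊎ δ s true ≡ t) ss

reachable? : ∀ {k} (δ : Fin k → Bool → Fin k) ss → Decidable (Reachable δ ss)
reachable? δ ss t = any? (λ s → (δ s false Fin.≟ t) ⊎-dec (δ s true Fin.≟ t)) ss

-- A level consists of the distinct states reachable at it, so every node below the source has an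
-- incoming edge and the width is at most the number of states.
successors : ∀ {k} → (Fin k → Bool → Fin k) → List (Fin k) → List (Fin k)
successors {k} δ ss = filter (reachable? δ ss) (allFin k)

∈-successors : ∀ {k} (δ : Fin k → Bool → Fin k) ss i b → δ (List.lookup ss i) b ∈ successors δ ss
∈-successors δ ss i b = ∈-filter⁺ (reachable? δ ss) (∈-allFin _) (Any.map (edge b) (∈-lookup i))
  where
  edge : ∀ {s} b → List.lookup ss i ≡ s →
         δ s false ≡ δ (List.lookup ss i) b ⊎ δ s true ≡ δ (List.lookup ss i) b
  edge false refl = inj₁ refl
  edge true refl = inj₂ refl

successor : ∀ {k} (δ : Fin k → Bool → Fin k) ss → Fin (length ss) → Bool → Fin (length (successors δ ss))
successor δ ss i b = Any.index (∈-successors δ ss i b)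

lookup-successor : ∀ {k} (δ : Fin k → Bool → Fin k) ss i b →
                   List.lookup (successors δ ss) (successor δ ss i b) ≡ δ (List.lookup ss i) b
lookup-successor δ ss i b = sym (lookup-index (∈-successors δ ss i b))

index-unique : ∀ {A : Set} {x : A} {xs} → Unique xs → (x∈xs : x ∈ xs) →
               ∀ j → x ≡ List.lookup xs j → Any.index x∈xs ≡ j
index-unique _ (here _) zero _ = refl
index-unique (x∉ys ∷ _) (here refl) (suc j) x≡ = ⊥-elim (All.lookup x∉ys (∈-lookup j) x≡)
index-unique (y∉ys ∷ _) (there x∈ys) zero refl = ⊥-elim (All.lookup y∉ys x∈ys refl)
index-unique (_ ∷ distinct) (there x∈ys) (suc j) x≡ = cong suc (index-unique distinct x∈ys j x≡)

successor-surjective : ∀ {k} (δ : Fin k → Bool → Fin k) ss j → ∃[ i ] ∃[ b ] successor δ ss i b ≡ j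
successor-surjective {k} δ ss j with ∈-filter⁻ (reachable? δ ss) {xs = allFin k} (∈-lookup j)
... | _ , reached = i , pick (lookup-index reached)
  where
  i = Any.index reached
  hit : ∀ b → δ (List.lookup ss i) b ≡ List.lookup (successors δ ss) j → successor δ ss i b ≡ j
  hit b = index-unique (Unique.filter⁺ (reachable? δ ss) (Unique.allFin⁺ k)) (∈-successors δ ss i b) j
  pick : δ (List.lookup ss i) false ≡ _ ⊎ δ (List.lookup ss i) true ≡ _ → ∃[ b ] successor δ ss i b ≡ j
  pick (inj₁ e) = false , hit false e
  pick (inj₂ e) = true , hit true e

compile : ∀ {n k} → (Fin k → Bool) → List (Step n (Fin k)) → (ss : List (Fin k)) → Layers n (length ss)
compile g [] ss = sinks (g ∘ List.lookup ss)
compile g ((v , δ) ∷ ts) ss = layer (λ _ → v) (successor δ ss) (compile g ts (successors δ ss))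

eval-compile : ∀ {n k} (g : Fin k → Bool) ts ss i (a : Vec Bool n) →
               eval (compile g ts ss) i a ≡ g (run ts (List.lookup ss i) a)
eval-compile g [] ss i a = refl
eval-compile g ((v , δ) ∷ ts) ss i a =
  trans (eval-compile g ts (successors δ ss) (successor δ ss i (lookup a v)) a)
        (cong (λ s → g (run ts s a)) (lookup-successor δ ss i (lookup a v)))

queries-compile : ∀ {n k} (g : Fin k → Bool) ts ss i (a : Vec Bool n) →
                  queries (compile g ts ss) i a ≡ variables ts
queries-compile g [] ss i a = refl
queries-compile g ((v , δ) ∷ ts) ss i a = cong (v ∷_) (queries-compile g ts _ _ a)

compile-width : ∀ {n k} (g : Fin k → Bool) (ts : List (Step n (Fin k))) ss →
                length ss ℕ.≤ k → WidthAtMost k (compile g ts ss)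
compile-width g [] ss ss≤k = ss≤k
compile-width {k = k} g ((v , δ) ∷ ts) ss ss≤k =
  ss≤k , compile-width g ts (successors δ ss) (ℕ.≤-trans (length-filter (reachable? δ ss) (allFin k))
                                                          (ℕ.≤-reflexive (length-tabulate (λ i → i))))

compile-oneSource : ∀ {n k} (g : Fin k → Bool) (ts : List (Step n (Fin k))) ss → OneSource (compile g ts ss)
compile-oneSource g [] ss = _
compile-oneSource g ((v , δ) ∷ ts) ss = successor-surjective δ ss , compile-oneSource g ts (successors δ ss)

toBP : ∀ {n k} → (Fin k → Bool) → List (Step n (Fin k)) → Fin k → BP n
toBP g ts s = compile g ts [ s ]

runBP-toBP : ∀ {n k} (g : Fin k → Bool) (ts : List (Step n (Fin k))) s a →
             runBP (toBP g ts s) a ≡ g (run ts s a)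
runBP-toBP g ts s = eval-compile g ts [ s ] zero

toBP-ROBP : ∀ {n k} (g : Fin k → Bool) (ts : List (Step n (Fin k))) s →
            Unique (variables ts) → IsROBP k (toBP g ts s)
toBP-ROBP g ts s distinct =
  compile-oneSource g ts [ s ] ,
  compile-width g ts [ s ] (1≤k s) ,
  λ a → subst Unique (sym (queries-compile g ts [ s ] zero a)) distinct
  where
  1≤k : ∀ {k} → Fin k → 1 ℕ.≤ k
  1≤k zero = s≤s z≤n
  1≤k (suc _) = s≤s z≤n

density-toBP : ∀ {n k} (g : Fin k → Bool) (ts : List (Step n (Fin k))) s → Unique (variables ts) →
               density (runBP (toBP g ts s)) ≡ value ts (indicator ∘ g) s
density-toBP g ts s distinct = trans (density-cong (runBP-toBP g ts s)) (density-run ts distinct g s)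

-- Testing agreement with c block by block

State : Set
State = Fin 3

pattern pass = zero
pattern wait = suc zero
pattern fail = suc (suc zero)

swap : State → State
swap pass = fail
swap wait = wait
swap fail = pass

swap-involutive : ∀ s → swap (swap s) ≡ s
swap-involutive pass = refl
swap-involutive wait = refl
swap-involutive fail = refl

accepting : State → Bool
accepting pass = true
accepting wait = false
accepting fail = false

accepting-pass : ∀ {s} → accepting s ≡ true → s ≡ pass
accepting-pass {pass} _ = refl
accepting-pass {wait} ()
accepting-pass {fail} ()

fail≢pass : _≢_ {A = State} fail pass
fail≢pass ()

match : (last cᵤ b : Bool) → State
match last cᵤ b = if does (b Bool.≟ cᵤ) then (if last then pass else wait) else fail

match-cases : ∀ last cᵤ b → (b ≡ cᵤ × match last cᵤ b ≡ (if last then pass else wait))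
                          ⊎ (b ≢ cᵤ × match last cᵤ b ≡ fail)
match-cases last cᵤ b with b Bool.≟ cᵤ
... | yes agree = inj₁ (agree , refl)
... | no disagree = inj₂ (disagree , refl)

mean-match : ∀ last cᵤ (f : State → ℚ) →
             mean (f ∘ match last cᵤ) ≡ ½ * f (if last then pass else wait) + ½ * f fail
mean-match last false f = refl
mean-match last true f = ℚ.+-comm (½ * f fail) (½ * f (if last then pass else wait))

-- At the first variable of a block, fail starts a fresh comparison; later it means that the
-- block has already disagreed with c.
agreeδ : (first last cᵤ : Bool) → State → Bool → State
agreeδ first last cᵤ pass b = pass
agreeδ first last cᵤ wait b = match last cᵤ b
agreeδ true last cᵤ fail b = match last cᵤ b
agreeδ false last cᵤ fail b = fail

agreeBlock : ∀ {n} → Vec Bool n → (first : Bool) → List (Fin n) → List (Step n State)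
agreeBlock c first [] = []
agreeBlock c first (u ∷ us) = (u , agreeδ first (null us) (lookup c u)) ∷ agreeBlock c false us

variables-agreeBlock : ∀ {n} (c : Vec Bool n) first us → variables (agreeBlock c first us) ≡ us
variables-agreeBlock c first [] = refl
variables-agreeBlock c first (u ∷ us) = cong (u ∷_) (variables-agreeBlock c false us)

run-agreeBlock-pass : ∀ {n} (c : Vec Bool n) first us a → run (agreeBlock c first us) pass a ≡ pass
run-agreeBlock-pass c first [] a = refl
run-agreeBlock-pass c first (u ∷ us) a = run-agreeBlock-pass c false us a

run-agreeBlock-fail : ∀ {n} (c : Vec Bool n) us a → run (agreeBlock c false us) fail a ≡ fail
run-agreeBlock-fail c [] a = refl
run-agreeBlock-fail c (u ∷ us) a = run-agreeBlock-fail c us a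

agreeBlock-outcome : ∀ {n} (c : Vec Bool n) first u us a →
  (All (λ i → lookup a i ≡ lookup c i) (u ∷ us) × run (agreeBlock c first (u ∷ us)) wait a ≡ pass) ⊎
  (Any (λ i → lookup a i ≢ lookup c i) (u ∷ us) × run (agreeBlock c first (u ∷ us)) wait a ≡ fail)
agreeBlock-outcome c first u [] a with match-cases true (lookup c u) (lookup a u)
... | inj₁ (agree , e) = inj₁ (agree ∷ [] , e)
... | inj₂ (disagree , e) = inj₂ (here disagree , e)
agreeBlock-outcome c first u (w ∷ ws) a
  with match false (lookup c u) (lookup a u) | match-cases false (lookup c u) (lookup a u)
... | _ | inj₂ (disagree , refl) = inj₂ (here disagree , run-agreeBlock-fail c (w ∷ ws) a)
... | _ | inj₁ (agree , refl) with agreeBlock-outcome c false w ws a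
...   | inj₁ (agrees , e) = inj₁ (agree ∷ agrees , e)
...   | inj₂ (disagrees , e) = inj₂ (there disagrees , e)

value-agreeBlock-pass : ∀ {n} (c : Vec Bool n) first us p → value (agreeBlock c first us) p pass ≡ p pass
value-agreeBlock-pass c first [] p = refl
value-agreeBlock-pass c first (u ∷ us) p =
  trans (mean-cong (λ _ → value-agreeBlock-pass c false us p)) (mean-const (p pass))

value-agreeBlock-fail : ∀ {n} (c : Vec Bool n) us p → value (agreeBlock c false us) p fail ≡ p fail
value-agreeBlock-fail c [] p = refl
value-agreeBlock-fail c (u ∷ us) p =
  trans (mean-cong (λ _ → value-agreeBlock-fail c us p)) (mean-const (p fail))

value-agreeBlock-wait : ∀ {n} (c : Vec Bool n) first u us p →
  value (agreeBlock c first (u ∷ us)) p wait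
    ≡ half^ (length (u ∷ us)) * p pass + (1ℚ - half^ (length (u ∷ us))) * p fail
value-agreeBlock-wait c first u [] p = mean-match true (lookup c u) p
value-agreeBlock-wait c first u (w ∷ ws) p = begin
  mean (rest ∘ match false (lookup c u))
    ≡⟨ mean-match false (lookup c u) rest ⟩
  ½ * rest wait + ½ * rest fail
    ≡⟨ cong₂ (λ x y → ½ * x + ½ * y) (value-agreeBlock-wait c false w ws p)
                                      (value-agreeBlock-fail c (w ∷ ws) p) ⟩
  ½ * (h * p pass + (1ℚ - h) * p fail) + ½ * p fail
    ≡⟨ halve-mixture ½ h (p pass) (p fail) ⟩
  (½ * h) * p pass + ((½ + ½) - ½ * h) * p fail
    ≡⟨⟩ -- ½ + ½ evaluates to 1ℚ
  (½ * h) * p pass + (1ℚ - ½ * h) * p fail               ∎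
  where
  open ≡-Reasoning
  rest = value (agreeBlock c false (w ∷ ws)) p
  h = half^ (length (w ∷ ws))
  halve-mixture : ∀ t h x y → t * (h * x + (1ℚ - h) * y) + t * y ≡ (t * h) * x + ((t + t) - t * h) * y
  halve-mixture = solve-∀ ℚ-ring

elements : ∀ {n} → Subset n → List (Fin n)
elements [] = []
elements (inside ∷ S) = zero ∷ map suc (elements S)
elements (outside ∷ S) = map suc (elements S)

∈-elements⁺ : ∀ {n} {x : Fin n} {S} → x ∈ₛ S → x ∈ elements S
∈-elements⁺ {S = inside ∷ S} V.here = here refl
∈-elements⁺ {S = inside ∷ S} (V.there x∈S) = there (∈-map⁺ suc (∈-elements⁺ x∈S))
∈-elements⁺ {S = outside ∷ S} (V.there x∈S) = ∈-map⁺ suc (∈-elements⁺ x∈S)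

∈-elements⁻ : ∀ {n} {x : Fin n} S → x ∈ elements S → x ∈ₛ S
∈-elements⁻ (inside ∷ S) (here refl) = V.here
∈-elements⁻ (inside ∷ S) (there x∈S) with ∈-map⁻ suc x∈S
... | _ , y∈S , refl = V.there (∈-elements⁻ S y∈S)
∈-elements⁻ (outside ∷ S) x∈S with ∈-map⁻ suc x∈S
... | _ , y∈S , refl = V.there (∈-elements⁻ S y∈S)

length-elements : ∀ {n} (S : Subset n) → length (elements S) ≡ ∣ S ∣
length-elements [] = refl
length-elements (inside ∷ S) = cong suc (trans (length-map suc (elements S)) (length-elements S))
length-elements (outside ∷ S) = trans (length-map suc (elements S)) (length-elements S)

elements-unique : ∀ {n} (S : Subset n) → Unique (elements S)
elements-unique [] = []
elements-unique (inside ∷ S) =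
  All-map⁺ (All.universal (λ _ ()) _) ∷ Unique.map⁺ suc-injective (elements-unique S)
elements-unique (outside ∷ S) = Unique.map⁺ suc-injective (elements-unique S)

PairwiseDisjoint : ∀ {n} → List (Subset n) → Set
PairwiseDisjoint Ss = ∀ i j → i ≢ j → Disjoint (List.lookup Ss i) (List.lookup Ss j)

elements-concat-unique : ∀ {n} (Ss : List (Subset n)) → PairwiseDisjoint Ss → Unique (concatMap elements Ss)
elements-concat-unique [] _ = []
elements-concat-unique (S ∷ Ss) disjoint =
  Unique.++⁺ (elements-unique S)
             (elements-concat-unique Ss (λ i j i≢j → disjoint (suc i) (suc j) (i≢j ∘ suc-injective)))
             apart
  where
  apart : ∀ {x} → x ∈ elements S × x ∈ concatMap elements Ss → ⊥
  apart (x∈S , x∈Ss) =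
    let x∈Sⱼ = ∈-concatMap⁻ elements {xs = Ss} x∈Ss in
    disjoint zero (suc (Any.index x∈Sⱼ)) (λ ()) _ (∈-elements⁻ S x∈S) (∈-elements⁻ _ (lookup-index x∈Sⱼ))

blockTest : ∀ {n} → Vec Bool n → Subset n → List (Step n State)
blockTest c S = agreeBlock c true (elements S)

blockTest-outcome : ∀ {n} (c : Vec Bool n) S a → Nonempty S →
  (AgreesOn a c S × run (blockTest c S) fail a ≡ pass) ⊎ (DiffersOn a c S × run (blockTest c S) fail a ≡ fail)
blockTest-outcome c S a (x , x∈S) =
  Sum.map (map₁ (λ agrees i i∈S → All.lookup agrees (∈-elements⁺ i∈S)))
          (map₁ (λ disagrees → let i , i∈S , disagree = find disagrees in i , ∈-elements⁻ S i∈S , disagree))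
          (start (elements S) (∈-elements⁺ x∈S))
  where
  start : ∀ us → x ∈ us →
    (All (λ i → lookup a i ≡ lookup c i) us × run (agreeBlock c true us) fail a ≡ pass) ⊎
    (Any (λ i → lookup a i ≢ lookup c i) us × run (agreeBlock c true us) fail a ≡ fail)
  start (u ∷ us) _ = agreeBlock-outcome c true u us a

value-blockTest : ∀ {n} (c : Vec Bool n) S p → Nonempty S →
                  value (blockTest c S) p fail ≡ half^ ∣ S ∣ * p pass + missProb S * p fail
value-blockTest c S p (x , x∈S) =
  trans (start (elements S) (∈-elements⁺ x∈S))
        (cong (λ k → half^ k * p pass + (1ℚ - half^ k) * p fail) (length-elements S))
  where
  start : ∀ us → x ∈ us →
    value (agreeBlock c true us) p fail ≡ half^ (length us) * p pass + (1ℚ - half^ (length us)) * p fail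
  start (u ∷ us) _ = value-agreeBlock-wait c true u us p

agreeBlocks : ∀ {n} → Vec Bool n → List (Subset n) → List (Step n State)
agreeBlocks c = concatMap (blockTest c)

variables-agreeBlocks : ∀ {n} (c : Vec Bool n) Ss → variables (agreeBlocks c Ss) ≡ concatMap elements Ss
variables-agreeBlocks c [] = refl
variables-agreeBlocks c (S ∷ Ss) =
  trans (map-++ proj₁ (blockTest c S) (agreeBlocks c Ss))
        (cong₂ _++_ (variables-agreeBlock c true (elements S)) (variables-agreeBlocks c Ss))

run-agreeBlocks-∷ : ∀ {n} (c : Vec Bool n) S Ss {s t} a → run (blockTest c S) s a ≡ t →
                    run (agreeBlocks c (S ∷ Ss)) s a ≡ run (agreeBlocks c Ss) t a
run-agreeBlocks-∷ c S Ss {s} a e =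
  trans (run-++ (blockTest c S) (agreeBlocks c Ss) s a) (cong (λ t → run (agreeBlocks c Ss) t a) e)

run-agreeBlocks-pass : ∀ {n} (c : Vec Bool n) Ss a → run (agreeBlocks c Ss) pass a ≡ pass
run-agreeBlocks-pass c [] a = refl
run-agreeBlocks-pass c (S ∷ Ss) a =
  trans (run-agreeBlocks-∷ c S Ss a (run-agreeBlock-pass c true (elements S) a)) (run-agreeBlocks-pass c Ss a)

agreeBlocks-outcome : ∀ {n} (c : Vec Bool n) Ss a → All Nonempty Ss →
  (Any (AgreesOn a c) Ss × run (agreeBlocks c Ss) fail a ≡ pass) ⊎
  (All (DiffersOn a c) Ss × run (agreeBlocks c Ss) fail a ≡ fail)
agreeBlocks-outcome c [] a [] = inj₂ ([] , refl)
agreeBlocks-outcome c (S ∷ Ss) a (nonempty ∷ nonempties) with blockTest-outcome c S a nonempty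
... | inj₁ (agrees , e) = inj₁ (here agrees , trans (run-agreeBlocks-∷ c S Ss a e) (run-agreeBlocks-pass c Ss a))
... | inj₂ (differs , e) with agreeBlocks-outcome c Ss a nonempties
...   | inj₁ (agreement , e′) = inj₁ (there agreement , trans (run-agreeBlocks-∷ c S Ss a e) e′)
...   | inj₂ (differences , e′) = inj₂ (differs ∷ differences , trans (run-agreeBlocks-∷ c S Ss a e) e′)

value-agreeBlocks-pass : ∀ {n} (c : Vec Bool n) Ss p → value (agreeBlocks c Ss) p pass ≡ p pass
value-agreeBlocks-pass c [] p = refl
value-agreeBlocks-pass c (S ∷ Ss) p =
  trans (value-++ (blockTest c S) (agreeBlocks c Ss) p pass)
        (trans (value-agreeBlock-pass c true (elements S) _) (value-agreeBlocks-pass c Ss p))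

value-agreeBlocks-fail : ∀ {n} (c : Vec Bool n) Ss p → All Nonempty Ss →
  value (agreeBlocks c Ss) p fail
    ≡ (1ℚ - prodQ (map missProb Ss)) * p pass + prodQ (map missProb Ss) * p fail
value-agreeBlocks-fail c [] p [] = no-blocks (p pass) (p fail)
  where
  no-blocks : ∀ x y → y ≡ (1ℚ - 1ℚ) * x + 1ℚ * y
  no-blocks = solve-∀ ℚ-ring
value-agreeBlocks-fail c (S ∷ Ss) p (nonempty ∷ nonempties) = begin
  value (blockTest c S ++ agreeBlocks c Ss) p fail
    ≡⟨ value-++ (blockTest c S) (agreeBlocks c Ss) p fail ⟩
  value (blockTest c S) rest fail
    ≡⟨ value-blockTest c S rest nonempty ⟩
  h * rest pass + (1ℚ - h) * rest fail
    ≡⟨ cong₂ (λ x y → h * x + (1ℚ - h) * y) (value-agreeBlocks-pass c Ss p)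
                                             (value-agreeBlocks-fail c Ss p nonempties) ⟩
  h * p pass + (1ℚ - h) * ((1ℚ - P) * p pass + P * p fail)
    ≡⟨ compose h P (p pass) (p fail) ⟩
  (1ℚ - (1ℚ - h) * P) * p pass + ((1ℚ - h) * P) * p fail     ∎
  where
  open ≡-Reasoning
  rest = value (agreeBlocks c Ss) p
  h = half^ ∣ S ∣
  P = prodQ (map missProb Ss)
  compose : ∀ h P x y → h * x + (1ℚ - h) * ((1ℚ - P) * x + P * y)
                      ≡ (1ℚ - (1ℚ - h) * P) * x + ((1ℚ - h) * P) * y
  compose = solve-∀ ℚ-ring

differBlocks : ∀ {n} → Vec Bool n → List (Subset n) → List (Step n State)
differBlocks c = conjugate swap ∘ agreeBlocks c

run-differBlocks-fail : ∀ {n} (c : Vec Bool n) Rs a → run (differBlocks c Rs) fail a ≡ fail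
run-differBlocks-fail c Rs a =
  trans (run-conjugate swap swap-involutive (agreeBlocks c Rs) fail a) (cong swap (run-agreeBlocks-pass c Rs a))

differBlocks-pass : ∀ {n} (c : Vec Bool n) Rs a → All Nonempty Rs →
                    run (differBlocks c Rs) pass a ≡ pass → All (DiffersOn a c) Rs
differBlocks-pass c Rs a nonempties stays with agreeBlocks-outcome c Rs a nonempties
... | inj₂ (differences , _) = differences
... | inj₁ (_ , e) = ⊥-elim (fail≢pass (begin
  swap pass                                ≡⟨ cong swap e ⟨
  swap (run (agreeBlocks c Rs) fail a)     ≡⟨ run-conjugate swap swap-involutive (agreeBlocks c Rs) pass a ⟨
  run (differBlocks c Rs) pass a           ≡⟨ stays ⟩
  pass                                     ∎))
  where open ≡-Reasoning

value-differBlocks-pass : ∀ {n} (c : Vec Bool n) Rs p → All Nonempty Rs →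
  value (differBlocks c Rs) p pass
    ≡ (1ℚ - prodQ (map missProb Rs)) * p fail + prodQ (map missProb Rs) * p pass
value-differBlocks-pass c Rs p nonempties =
  trans (value-conjugate swap swap-involutive (agreeBlocks c Rs) p pass)
        (value-agreeBlocks-fail c Rs (p ∘ swap) nonempties)

value-differBlocks-fail : ∀ {n} (c : Vec Bool n) Rs p → value (differBlocks c Rs) p fail ≡ p fail
value-differBlocks-fail c Rs p =
  trans (value-conjugate swap swap-involutive (agreeBlocks c Rs) p fail) (value-agreeBlocks-pass c Rs (p ∘ swap))

richnessTest : ∀ {n} → Vec Bool n → List (Subset n) → List (Subset n) → List (Step n State)
richnessTest c Qs Rs = agreeBlocks c Qs ++ differBlocks c Rs

-- With no Q-blocks the first condition is vacuous, so the test starts as if it had been met.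
initial : ∀ {n} → List (Subset n) → State
initial [] = pass
initial (_ ∷ _) = fail

variables-richnessTest : ∀ {n} (c : Vec Bool n) Qs Rs →
                         variables (richnessTest c Qs Rs) ≡ concatMap elements (Qs ++ Rs)
variables-richnessTest c Qs Rs = begin
  variables (agreeBlocks c Qs ++ differBlocks c Rs)
    ≡⟨ map-++ proj₁ (agreeBlocks c Qs) (differBlocks c Rs) ⟩
  variables (agreeBlocks c Qs) ++ variables (conjugate swap (agreeBlocks c Rs))
    ≡⟨ cong (variables (agreeBlocks c Qs) ++_) (variables-conjugate swap (agreeBlocks c Rs)) ⟩
  variables (agreeBlocks c Qs) ++ variables (agreeBlocks c Rs)
    ≡⟨ cong₂ _++_ (variables-agreeBlocks c Qs) (variables-agreeBlocks c Rs) ⟩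
  concatMap elements Qs ++ concatMap elements Rs
    ≡⟨ concat-++ (map elements Qs) (map elements Rs) ⟩
  List.concat (map elements Qs ++ map elements Rs)
    ≡⟨ cong List.concat (map-++ elements Qs Rs) ⟨
  concatMap elements (Qs ++ Rs)                                        ∎
  where open ≡-Reasoning

richnessTest-unique : ∀ {n} (c : Vec Bool n) Qs Rs → PairwiseDisjoint (Qs ++ Rs) →
                      Unique (variables (richnessTest c Qs Rs))
richnessTest-unique c Qs Rs disjoint =
  subst Unique (sym (variables-richnessTest c Qs Rs)) (elements-concat-unique (Qs ++ Rs) disjoint)

value-richnessTest : ∀ {n} (c : Vec Bool n) Qs Rs → All Nonempty Qs → All Nonempty Rs →
                     value (richnessTest c Qs Rs) (indicator ∘ accepting) (initial Qs) ≡ richValue Qs Rs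
value-richnessTest c [] Rs [] nonemptyR =
  trans (value-differBlocks-pass c Rs _ nonemptyR) (only-R (prodQ (map missProb Rs)))
  where
  only-R : ∀ R → (1ℚ - R) * 0ℚ + R * 1ℚ ≡ 1ℚ * R
  only-R = solve-∀ ℚ-ring
value-richnessTest c Qs@(_ ∷ _) Rs nonemptyQ nonemptyR = begin
  value (agreeBlocks c Qs ++ differBlocks c Rs) p fail
    ≡⟨ value-++ (agreeBlocks c Qs) (differBlocks c Rs) p fail ⟩
  value (agreeBlocks c Qs) rest fail
    ≡⟨ value-agreeBlocks-fail c Qs rest nonemptyQ ⟩
  (1ℚ - P) * rest pass + P * rest fail
    ≡⟨ cong₂ (λ x y → (1ℚ - P) * x + P * y) (value-differBlocks-pass c Rs p nonemptyR)
                                            (value-differBlocks-fail c Rs p) ⟩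
  (1ℚ - P) * ((1ℚ - R) * 0ℚ + R * 1ℚ) + P * 0ℚ
    ≡⟨ both P R ⟩
  (1ℚ - P) * R                                                         ∎
  where
  open ≡-Reasoning
  p = indicator ∘ accepting
  rest = value (differBlocks c Rs) p
  P = prodQ (map missProb Qs)
  R = prodQ (map missProb Rs)
  both : ∀ P R → (1ℚ - P) * ((1ℚ - R) * 0ℚ + R * 1ℚ) + P * 0ℚ ≡ (1ℚ - P) * R
  both = solve-∀ ℚ-ring

richnessTest-sound : ∀ {n} (c : Vec Bool n) Qs Rs a → All Nonempty Qs → All Nonempty Rs →
                     accepting (run (richnessTest c Qs Rs) (initial Qs) a) ≡ true →
                     QCond a c Qs × All (DiffersOn a c) Rs
richnessTest-sound c [] Rs a [] nonemptyR accepted =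
  _ , differBlocks-pass c Rs a nonemptyR (accepting-pass accepted)
richnessTest-sound c Qs@(_ ∷ _) Rs a nonemptyQ nonemptyR accepted =
  [ (λ (agreement , e) → agreement , differBlocks-pass c Rs a nonemptyR (passes-from e))
  , (λ (_ , e) → ⊥-elim (fail≢pass (trans (sym (run-differBlocks-fail c Rs a)) (passes-from e))))
  ]′ (agreeBlocks-outcome c Qs a nonemptyQ)
  where
  passes-from : ∀ {t} → run (agreeBlocks c Qs) fail a ≡ t → run (differBlocks c Rs) t a ≡ pass
  passes-from e = trans (cong (λ t → run (differBlocks c Rs) t a) (sym e))
                        (trans (sym (run-++ (agreeBlocks c Qs) (differBlocks c Rs) fail a)) (accepting-pass accepted))

richnessProgram : ∀ {n} → Vec Bool n → List (Subset n) → List (Subset n) → BP n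
richnessProgram c Qs Rs = toBP accepting (richnessTest c Qs Rs) (initial Qs)

richnessProgram-ROBP : ∀ {n} (c : Vec Bool n) Qs Rs → PairwiseDisjoint (Qs ++ Rs) →
                       IsROBP 3 (richnessProgram c Qs Rs)
richnessProgram-ROBP c Qs Rs disjoint =
  toBP-ROBP accepting (richnessTest c Qs Rs) (initial Qs) (richnessTest-unique c Qs Rs disjoint)

density-richnessProgram : ∀ {n} (c : Vec Bool n) Qs Rs → All Nonempty Qs → All Nonempty Rs →
                          PairwiseDisjoint (Qs ++ Rs) → density (runBP (richnessProgram c Qs Rs)) ≡ richValue Qs Rs
density-richnessProgram c Qs Rs nonemptyQ nonemptyR disjoint =
  trans (density-toBP accepting (richnessTest c Qs Rs) (initial Qs) (richnessTest-unique c Qs Rs disjoint))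
        (value-richnessTest c Qs Rs nonemptyQ nonemptyR)

richnessProgram-sound : ∀ {n} (c : Vec Bool n) Qs Rs a → All Nonempty Qs → All Nonempty Rs →
                        runBP (richnessProgram c Qs Rs) a ≡ true → QCond a c Qs × All (DiffersOn a c) Rs
richnessProgram-sound c Qs Rs a nonemptyQ nonemptyR accepted =
  richnessTest-sound c Qs Rs a nonemptyQ nonemptyR
    (trans (sym (runBP-toBP accepting (richnessTest c Qs Rs) (initial Qs) a)) accepted)

proposition1 : (ε : PosReal) (H : Lang) → IsHittingSetROBP3 ε H → IsWeaklyRich ε H
proposition1 ε H (n₀ , hits) = n₀ , λ n n₀≤n I Qs Rs c (nonempty , disjoint , _) ε≤richValue →
  let nonemptyQ , nonemptyR = ++⁻ Qs nonempty
      a , a∈H , accepted = hits n n₀≤n (richnessProgram c Qs Rs) (richnessProgram-ROBP c Qs Rs disjoint)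
        (subst (PosReal.Ge ε) (sym (density-richnessProgram c Qs Rs nonemptyQ nonemptyR disjoint)) ε≤richValue)
  in a , a∈H , richnessProgram-sound c Qs Rs a nonemptyQ nonemptyR accepted
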